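{- Let $s\geq 4$ be an even integer. For every integer $n\geq 0$, \[ M_{s}(n)=C_{s}(n)=D_{s}(n). \]
   Context: $M_s(n)$ is the number of partitions of $n$ in which every part occurs with multiplicity congruent to $0$ or $1$ modulo $s$. $C_s(n)$ is the number of partitions of $n$ none of whose parts is congruent to $2,4,\dots,s-2$ modulo $s$. $D_s(n)$ is the number of partitions of $n$ in which every part occurring with multiplicity greater than one is divisible by $s/2$. All three equal $1$ for $n=0$. -}

module Defs where

open import Data.Nat using (ℕ; zero; suc; _∸_; _≡ᵇ_; _≤ᵇ_; _%_; _/_)
open import Data.Bool using (Bool; true; false; _∧_; _∨_; not)
open import Data.List using (List; []; _∷_; length; filter; map; concatMap; upTo)
open import Data.Bool.ListAction using (all)
open import Relation.Nullary.Decidable using (T?)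
open import Data.Bool using (T)

-- A partition of n is represented as a non-increasing list of positive
-- integers (its parts, repeated according to multiplicity) summing to n.

-- partitionsBounded fuel n m : all partitions of n whose parts are all ≤ m,
-- each listed once as a non-increasing list.  Complete whenever fuel ≥ n
-- (each step removes a part ≥ 1).
partitionsBounded : ℕ → ℕ → ℕ → List (List ℕ)
partitionsBounded _ zero _ = [] ∷ []
partitionsBounded zero (suc _) _ = []
partitionsBounded (suc f) n m =
  concatMap (λ k → map (λ p → suc k ∷ p) (partitionsBounded f (n ∸ suc k) (suc k)))
            (filter (λ k → T? ((suc k ≤ᵇ n) ∧ (suc k ≤ᵇ m))) (upTo n))

partitions : ℕ → List (List ℕ)
partitions n = partitionsBounded n n n

mult : ℕ → List ℕ → ℕ
mult k [] = 0
mult k (x ∷ p) with x ≡ᵇ k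
... | true  = suc (mult k p)
... | false = mult k p

countPartitions : (List ℕ → Bool) → ℕ → ℕ
countPartitions P n = length (filter (λ p → T? (P p)) (partitions n))

divᵇ : ℕ → ℕ → Bool
divᵇ zero a = a ≡ᵇ 0
divᵇ (suc d) a = (a % suc d) ≡ᵇ 0

-- M_s(n): every part occurs with multiplicity ≡ 0 or 1 (mod s)
M : ℕ → ℕ → ℕ
M s = countPartitions (λ p → all (λ k → divᵇ s (mult k p) ∨ divᵇ s (mult k p ∸ 1)) p)
-- (parts occurring in p have multiplicity ≥ 1, so "mult ∸ 1 divisible by s"
--  is exactly "mult ≡ 1 mod s")

-- remainder of a modulo d (d = 0 is never used: s ≥ 4 in the theorem)
modℕ : ℕ → ℕ → ℕ
modℕ zero a = a
modℕ (suc d) a = a % suc d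

-- C_s(n): no part is congruent to one of 2, 4, …, s-2 modulo s.
-- For even s the residues 2, 4, …, s-2 are exactly the even nonzero
-- residues mod s, so a part k is forbidden iff (k mod s) is nonzero and even.
C : ℕ → ℕ → ℕ
C s = countPartitions (λ p → all (λ k → not (not (modℕ s k ≡ᵇ 0) ∧ divᵇ 2 (modℕ s k))) p)

D : ℕ → ℕ → ℕ
D s = countPartitions (λ p → all (λ k → (mult k p ≤ᵇ 1) ∨ divᵇ (s / 2) k) p)

{-# OPTIONS --safe #-}
module Submission where

-- Work with power series in q, truncated at degree n. Partitions whose part k may occur with
-- the multiplicities allowed by a condition have generating function ∏ₖ Σ_{c allowed} q^{kc}.
-- For the three conditions the factor of the part k is
--   M:  1 + q^k + q^{sk} + q^{(s+1)k} + ⋯ = (1 + q^k) / (1 − q^{sk}),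
--   C:  1 / (1 − q^k) if k is odd or s ∣ k, and 1 otherwise,
--   D:  1 / (1 − q^k) = (1 + q^k) / (1 − q^{2k}) if s/2 ∣ k, and 1 + q^k otherwise.
-- Euler's identity ∏_{k odd} 1 / (1 − q^k) = ∏ₖ (1 + q^k) then turns each product into
-- ∏ₖ (1 + q^k) · ∏ⱼ 1 / (1 − q^{sj}). Both kinds of factor act as operators on
-- coefficient sequences; they commute, and degree n of the result only depends on
-- degrees ≤ n of the input.

open import Defs

open import Data.Bool using (Bool; true; false; not; _∧_; _∨_; T)
open import Data.Bool.ListAction using (all)
open import Data.Bool.Properties using (∧-assoc; ∧-idem; ∧-identityʳ; T-∧)
open import Data.List
  using (List; []; _∷_; _++_; length; filter; map; concatMap; replicate; applyUpTo; upTo)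
open import Data.List.Relation.Unary.All as All using (All; []; _∷_)
open import Data.List.Relation.Unary.All.Properties using (++⁺; map⁺)
open import Data.Nat
  using (ℕ; zero; suc; _+_; _*_; _∸_; _≤_; _<_; z≤n; s≤s; z<s; _≡ᵇ_; _≤ᵇ_; _<ᵇ_)
open import Data.Nat.DivMod
  using (_%_; [m+n]%n≡m%n; [m+kn]%n≡m%n; m*n%n≡0; m<n⇒m%n≡m; m∣n⇒o%n%m≡o%m;
         m*n/n≡m)
open import Data.Nat.Divisibility using (_∣_; divides)
open import Data.Nat.Properties
open import Algebra.Properties.CommutativeSemigroup +-commutativeSemigroup
  using () renaming (interchange to +-interchange)
open import Data.Nat.Tactic.RingSolver using (solve-∀)
open import Data.Product using (_×_; _,_; proj₂)
open import Function using (_∘_)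
open import Function.Bundles using (Equivalence)
open import Relation.Binary.Definitions using (tri<; tri≈; tri>)
open import Relation.Binary.PropositionalEquality
open import Relation.Nullary using (¬_; contradiction)
open import Relation.Nullary.Decidable using (T?)

-- Truncated power series

Series : Set
Series = ℕ → ℕ

_⊕_ : Series → Series → Series
(f ⊕ g) n = f n + g n

δ : Series
δ zero    = 1
δ (suc _) = 0

shift : ℕ → Series → Series
shift zero    f n       = f n
shift (suc k) f zero    = 0
shift (suc k) f (suc n) = shift k f n

_≈[_]_ : Series → ℕ → Series → Set
f ≈[ N ] g = ∀ m → m ≤ N → f m ≡ g m

≈[]-trans : ∀ {f g h : Series} N → f ≈[ N ] g → g ≈[ N ] h → f ≈[ N ] h
≈[]-trans N p q m m≤N = trans (p m m≤N) (q m m≤N)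

shift-≈ : ∀ k {f g} n → f ≈[ n ] g → shift k f n ≡ shift k g n
shift-≈ zero    n       f≈g = f≈g n ≤-refl
shift-≈ (suc k) zero    f≈g = refl
shift-≈ (suc k) (suc n) f≈g = shift-≈ k n (λ m m≤n → f≈g m (m≤n⇒m≤1+n m≤n))

shift-suc-≈ : ∀ k {f g : Series} n → (∀ m → m < n → f m ≡ g m) →
  shift (suc k) f n ≡ shift (suc k) g n
shift-suc-≈ k zero    f≈g = refl
shift-suc-≈ k (suc n) f≈g = shift-≈ k n (λ m m≤n → f≈g m (s≤s m≤n))

shift-cong : ∀ k {f g} → f ≗ g → shift k f ≗ shift k g
shift-cong k f≗g n = shift-≈ k n (λ m _ → f≗g m)

shift-below : ∀ k f {n} → n < k → shift k f n ≡ 0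
shift-below (suc k) f {zero}  _         = refl
shift-below (suc k) f {suc n} (s≤s n<k) = shift-below k f n<k

shift-0 : ∀ k → shift k (λ _ → 0) ≗ λ _ → 0
shift-0 zero    n       = refl
shift-0 (suc k) zero    = refl
shift-0 (suc k) (suc n) = shift-0 k n

shift-⊕ : ∀ k f g → shift k (f ⊕ g) ≗ shift k f ⊕ shift k g
shift-⊕ zero    f g n       = refl
shift-⊕ (suc k) f g zero    = refl
shift-⊕ (suc k) f g (suc n) = shift-⊕ k f g n

shift-shift : ∀ a b f → shift a (shift b f) ≗ shift (a + b) f
shift-shift zero    b f n       = refl
shift-shift (suc a) b f zero    = refl
shift-shift (suc a) b f (suc n) = shift-shift a b f n

shift-comm : ∀ a b f → shift a (shift b f) ≗ shift b (shift a f)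
shift-comm a b f n = begin
  shift a (shift b f) n  ≡⟨ shift-shift a b f n ⟩
  shift (a + b) f n      ≡⟨ cong (λ k → shift k f n) (+-comm a b) ⟩
  shift (b + a) f n      ≡⟨ shift-shift b a f n ⟨
  shift b (shift a f) n  ∎
  where open ≡-Reasoning

infixr 7 _·_
_·_ : Bool → ℕ → ℕ
true  · x = x
false · x = 0

·-distribˡ-+ : ∀ b x y → b · (x + y) ≡ b · x + b · y
·-distribˡ-+ true  x y = refl
·-distribˡ-+ false x y = refl

·-zeroʳ : ∀ b → b · 0 ≡ 0
·-zeroʳ true  = refl
·-zeroʳ false = refl

shift-· : ∀ k f n → shift k f n ≡ (k <ᵇ suc n) · f (n ∸ k)
shift-· zero    f n       = refl
shift-· (suc k) f zero    = refl
shift-· (suc k) f (suc n) = shift-· k f n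

factorFuel : ℕ → ℕ → (ℕ → Bool) → Series → Series
factorFuel zero    k g h n = 0
factorFuel (suc F) k g h n = g 0 · h n + shift k (factorFuel F k (g ∘ suc) h) n

-- factor k g h = (Σ_{c : g c} q^{kc}) h. For k ≥ 1 only the terms c ≤ n reach degree n.
factor : ℕ → (ℕ → Bool) → Series → Series
factor k g h n = factorFuel (suc n) k g h n

factorFuel-stable : ∀ F F' k g h n → n < F → n < F' →
  factorFuel F (suc k) g h n ≡ factorFuel F' (suc k) g h n
factorFuel-stable (suc F) (suc F') k g h n (s≤s n≤F) (s≤s n≤F') =
  cong (g 0 · h n +_) (shift-suc-≈ k n (λ m m<n →
    factorFuel-stable F F' k (g ∘ suc) h m (<-≤-trans m<n n≤F) (<-≤-trans m<n n≤F')))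

factorFuel-≈ : ∀ F k {g g' h h'} n → (∀ c → g c ≡ g' c) → h ≈[ n ] h' →
  factorFuel F k g h n ≡ factorFuel F k g' h' n
factorFuel-≈ zero    k n g≗g' h≈h' = refl
factorFuel-≈ (suc F) k n g≗g' h≈h' =
  cong₂ _+_ (cong₂ _·_ (g≗g' 0) (h≈h' n ≤-refl))
            (shift-≈ k n (λ m m≤n → factorFuel-≈ F k m (g≗g' ∘ suc)
                                       (λ m' m'≤m → h≈h' m' (≤-trans m'≤m m≤n))))

factorFuel-never : ∀ F k g h n → (∀ c → g c ≡ false) → factorFuel F k g h n ≡ 0
factorFuel-never zero    k g h n never = refl
factorFuel-never (suc F) k g h n never rewrite never 0 =
  trans (shift-cong k (λ m → factorFuel-never F k (g ∘ suc) h m (never ∘ suc)) n)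
        (shift-0 k n)

factor-unfold : ∀ k g h n →
  factor (suc k) g h n ≡ g 0 · h n + shift (suc k) (factor (suc k) (g ∘ suc) h) n
factor-unfold k g h n = cong (g 0 · h n +_) (shift-suc-≈ k n (λ m m<n →
  factorFuel-stable n (suc m) k (g ∘ suc) h m m<n ≤-refl))

factor-≈ : ∀ k {g g' h h'} n → (∀ c → g c ≡ g' c) → h ≈[ n ] h' →
  factor k g h n ≡ factor k g' h' n
factor-≈ k n = factorFuel-≈ (suc n) k n

factor-cong : ∀ k {g g'} h → (∀ c → g c ≡ g' c) → factor k g h ≗ factor k g' h
factor-cong k h g≗g' n = factor-≈ k n g≗g' (λ _ _ → refl)

factor-never : ∀ k g h → (∀ c → g c ≡ false) → factor k g h ≗ λ _ → 0
factor-never k g h never n = factorFuel-never (suc n) k g h n never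

A : ℕ → Series → Series
A k h = h ⊕ shift k h

-- E k h = h / (1 − q^k); E 0 is the identity rather than the meaningless h / 0.
E : ℕ → Series → Series
E zero    h = h
E (suc k) h = factor (suc k) (λ _ → true) h

E-unfold : ∀ k h n → E (suc k) h n ≡ h n + shift (suc k) (E (suc k) h) n
E-unfold k h = factor-unfold k (λ _ → true) h

E-unique : ∀ k u X → (∀ n → X n ≡ u n + shift (suc k) X n) → X ≗ E (suc k) u
E-unique k u X X-eq n = go (suc n) n ≤-refl
  where
  go : ∀ N m → m < N → X m ≡ E (suc k) u m
  go (suc N) m (s≤s m≤N) = begin
    X m                                  ≡⟨ X-eq m ⟩
    u m + shift (suc k) X m              ≡⟨ cong (u m +_) (shift-suc-≈ k m (λ m' m'<m →
                                              go N m' (<-≤-trans m'<m m≤N))) ⟩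
    u m + shift (suc k) (E (suc k) u) m  ≡⟨ E-unfold k u m ⟨
    E (suc k) u m                        ∎
    where open ≡-Reasoning

A-≈ : ∀ k N {h h'} → h ≈[ N ] h' → A k h ≈[ N ] A k h'
A-≈ k N h≈h' m m≤N =
  cong₂ _+_ (h≈h' m m≤N) (shift-≈ k m (λ m' m'≤m → h≈h' m' (≤-trans m'≤m m≤N)))

E-≈ : ∀ k N {h h'} → h ≈[ N ] h' → E k h ≈[ N ] E k h'
E-≈ zero    N h≈h' = h≈h'
E-≈ (suc k) N h≈h' m m≤N =
  factor-≈ (suc k) {λ _ → true} m (λ _ → refl)
           (λ m' m'≤m → h≈h' m' (≤-trans m'≤m m≤N))


-- Operators

E-natural : ∀ k (T : Series → Series) → (∀ {f g} → f ≗ g → T f ≗ T g) →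
  (∀ f g → T (f ⊕ g) ≗ T f ⊕ T g) → (∀ f → T (shift k f) ≗ shift k (T f)) →
  ∀ h → T (E k h) ≗ E k (T h)
E-natural zero    T T-cong T-⊕ T-shift h n = refl
E-natural (suc k) T T-cong T-⊕ T-shift h = E-unique k (T h) (T (E (suc k) h)) λ n → begin
  T (E (suc k) h) n                          ≡⟨ T-cong (E-unfold k h) n ⟩
  T (h ⊕ shift (suc k) (E (suc k) h)) n      ≡⟨ T-⊕ h _ n ⟩
  T h n + T (shift (suc k) (E (suc k) h)) n  ≡⟨ cong (T h n +_) (T-shift _ n) ⟩
  T h n + shift (suc k) (T (E (suc k) h)) n  ∎
  where open ≡-Reasoning

A-natural : ∀ k (T : Series → Series) → (∀ f g → T (f ⊕ g) ≗ T f ⊕ T g) →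
  (∀ f → T (shift k f) ≗ shift k (T f)) → ∀ h → T (A k h) ≗ A k (T h)
A-natural k T T-⊕ T-shift h n = trans (T-⊕ h (shift k h) n) (cong (T h n +_) (T-shift h n))

E-⊕ : ∀ k f g → E k (f ⊕ g) ≗ E k f ⊕ E k g
E-⊕ zero    f g n = refl
E-⊕ (suc k) f g   = sym ∘ E-unique k (f ⊕ g) (Ef ⊕ Eg) λ n → begin
  Ef n + Eg n
    ≡⟨ cong₂ _+_ (E-unfold k f n) (E-unfold k g n) ⟩
  (f n + shift (suc k) Ef n) + (g n + shift (suc k) Eg n)
    ≡⟨ +-interchange (f n) _ (g n) _ ⟩
  (f n + g n) + (shift (suc k) Ef n + shift (suc k) Eg n)
    ≡⟨ cong (f n + g n +_) (shift-⊕ (suc k) Ef Eg n) ⟨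
  (f n + g n) + shift (suc k) (Ef ⊕ Eg) n
    ∎
  where
  open ≡-Reasoning
  Ef = E (suc k) f
  Eg = E (suc k) g

A-⊕ : ∀ k f g → A k (f ⊕ g) ≗ A k f ⊕ A k g
A-⊕ k f g n = trans (cong (f n + g n +_) (shift-⊕ k f g n)) (+-interchange (f n) (g n) _ _)

E-shift : ∀ k a h → E k (shift a h) ≗ shift a (E k h)
E-shift k a h =
  sym ∘ E-natural k (shift a) (shift-cong a) (shift-⊕ a) (λ f → shift-comm a k f) h

A-shift : ∀ k a h → A k (shift a h) ≗ shift a (A k h)
A-shift k a h = sym ∘ A-natural k (shift a) (shift-⊕ a) (λ f → shift-comm a k f) h

infixr 5 _⊙_
data Op : Set where
  idₒ   : Op
  Aₒ Eₒ : ℕ → Op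
  _⊙_   : Op → Op → Op

⟦_⟧ : Op → Series → Series
⟦ idₒ ⟧    h = h
⟦ Aₒ k ⟧   h = A k h
⟦ Eₒ k ⟧   h = E k h
⟦ o ⊙ o' ⟧ h = ⟦ o ⟧ (⟦ o' ⟧ h)

infix 4 _≈ₒ_
_≈ₒ_ : Op → Op → Set
o ≈ₒ o' = ∀ h → ⟦ o ⟧ h ≗ ⟦ o' ⟧ h

⟦⟧-≈ : ∀ o N {h h'} → h ≈[ N ] h' → ⟦ o ⟧ h ≈[ N ] ⟦ o ⟧ h'
⟦⟧-≈ idₒ      N h≈h' = h≈h'
⟦⟧-≈ (Aₒ k)   N h≈h' = A-≈ k N h≈h'
⟦⟧-≈ (Eₒ k)   N h≈h' = E-≈ k N h≈h'
⟦⟧-≈ (o ⊙ o') N h≈h' = ⟦⟧-≈ o N (⟦⟧-≈ o' N h≈h')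

⟦⟧-cong : ∀ o {h h'} → h ≗ h' → ⟦ o ⟧ h ≗ ⟦ o ⟧ h'
⟦⟧-cong o h≗h' n = ⟦⟧-≈ o n (λ m _ → h≗h' m) n ≤-refl

⟦⟧-⊕ : ∀ o f g → ⟦ o ⟧ (f ⊕ g) ≗ ⟦ o ⟧ f ⊕ ⟦ o ⟧ g
⟦⟧-⊕ idₒ      f g n = refl
⟦⟧-⊕ (Aₒ k)   f g   = A-⊕ k f g
⟦⟧-⊕ (Eₒ k)   f g   = E-⊕ k f g
⟦⟧-⊕ (o ⊙ o') f g n =
  trans (⟦⟧-cong o (⟦⟧-⊕ o' f g) n) (⟦⟧-⊕ o (⟦ o' ⟧ f) (⟦ o' ⟧ g) n)

⟦⟧-shift : ∀ o a h → ⟦ o ⟧ (shift a h) ≗ shift a (⟦ o ⟧ h)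
⟦⟧-shift idₒ      a h n = refl
⟦⟧-shift (Aₒ k)   a h   = A-shift k a h
⟦⟧-shift (Eₒ k)   a h   = E-shift k a h
⟦⟧-shift (o ⊙ o') a h n =
  trans (⟦⟧-cong o (⟦⟧-shift o' a h) n) (⟦⟧-shift o a (⟦ o' ⟧ h) n)

⟦⟧-comm : ∀ o o' h → ⟦ o ⟧ (⟦ o' ⟧ h) ≗ ⟦ o' ⟧ (⟦ o ⟧ h)
⟦⟧-comm idₒ      o' h n = refl
⟦⟧-comm (Aₒ k)   o' h   =
  sym ∘ A-natural k ⟦ o' ⟧ (⟦⟧-⊕ o') (λ f → ⟦⟧-shift o' k f) h
⟦⟧-comm (Eₒ k)   o' h   =
  sym ∘ E-natural k ⟦ o' ⟧ (⟦⟧-cong o') (⟦⟧-⊕ o') (λ f → ⟦⟧-shift o' k f) h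
⟦⟧-comm (o ⊙ o₁) o' h n =
  trans (⟦⟧-cong o (⟦⟧-comm o₁ o' h) n) (⟦⟧-comm o o' (⟦ o₁ ⟧ h) n)

when : Bool → Op → Op
when true  o = o
when false o = idₒ

when-true : ∀ {b} o → b ≡ true → when b o ≈ₒ o
when-true o refl h n = refl

when-false : ∀ {b} o → b ≡ false → when b o ≈ₒ idₒ
when-false o refl h n = refl

prod : (ℕ → Op) → ℕ → Op
prod F zero    = idₒ
prod F (suc m) = F (suc m) ⊙ prod F m

prod-cong : ∀ F G m → (∀ i → i < m → F (suc i) ≈ₒ G (suc i)) →
  prod F m ≈ₒ prod G m
prod-cong F G zero    F≈G h n = refl
prod-cong F G (suc m) F≈G h n =
  trans (⟦⟧-cong (F (suc m)) (prod-cong F G m (λ i i<m → F≈G i (m<n⇒m<1+n i<m)) h) n)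
        (F≈G m ≤-refl (⟦ prod G m ⟧ h) n)

prod-⊙ : ∀ F G m → prod (λ k → F k ⊙ G k) m ≈ₒ prod F m ⊙ prod G m
prod-⊙ F G zero    h n = refl
prod-⊙ F G (suc m) h n =
  trans (⟦⟧-cong (F (suc m) ⊙ G (suc m)) (prod-⊙ F G m h) n)
        (⟦⟧-cong (F (suc m)) (⟦⟧-comm (G (suc m)) (prod F m) (⟦ prod G m ⟧ h)) n)

prod-skip : ∀ G a r → (∀ i → i < r → G (suc i + a) ≈ₒ idₒ) →
  prod G (r + a) ≈ₒ prod G a
prod-skip G a zero    G≈id h n = refl
prod-skip G a (suc r) G≈id h n =
  trans (G≈id r ≤-refl _ n) (prod-skip G a r (λ i i<r → G≈id i (m<n⇒m<1+n i<r)) h n)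

prod-peel : ∀ F r → prod F (suc r) ≈ₒ prod (F ∘ suc) r ⊙ F 1
prod-peel F zero    h n = refl
prod-peel F (suc r) h n = ⟦⟧-cong (F (suc (suc r))) (prod-peel F r h) n

IdUpTo : ℕ → Op → Set
IdUpTo N o = ∀ h → ⟦ o ⟧ h ≈[ N ] h

E-IdUpTo : ∀ N d → N < d → IdUpTo N (Eₒ d)
E-IdUpTo N (suc k) N<d h m m≤N = begin
  E (suc k) h m
    ≡⟨ E-unfold k h m ⟩
  h m + shift (suc k) (E (suc k) h) m
    ≡⟨ cong (h m +_) (shift-below (suc k) _ (≤-<-trans m≤N N<d)) ⟩
  h m + 0
    ≡⟨ +-identityʳ (h m) ⟩
  h m
    ∎
  where open ≡-Reasoning

A-IdUpTo : ∀ N k → N < k → IdUpTo N (Aₒ k)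
A-IdUpTo N k N<k h m m≤N =
  trans (cong (h m +_) (shift-below k h (≤-<-trans m≤N N<k))) (+-identityʳ (h m))

when-IdUpTo : ∀ N b {o} → IdUpTo N o → IdUpTo N (when b o)
when-IdUpTo N true  o-id = o-id
when-IdUpTo N false o-id h m _ = refl

prod-IdUpTo : ∀ N F m → (∀ i → i < m → IdUpTo N (F (suc i))) → IdUpTo N (prod F m)
prod-IdUpTo N F zero    F-id h m _ = refl
prod-IdUpTo N F (suc m) F-id h =
  ≈[]-trans N (F-id m ≤-refl (⟦ prod F m ⟧ h))
              (prod-IdUpTo N F m (λ i i<m → F-id i (m<n⇒m<1+n i<m)) h)

prod-pad : ∀ N F m r → (∀ i → m ≤ i → IdUpTo N (F (suc i))) →
  ∀ h → ⟦ prod F (r + m) ⟧ h ≈[ N ] ⟦ prod F m ⟧ h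
prod-pad N F m zero    F-id h m' _ = refl
prod-pad N F m (suc r) F-id h =
  ≈[]-trans N (F-id (r + m) (m≤n+m m r) _) (prod-pad N F m r F-id h)

prod-pad-* : ∀ N d F → (∀ i → N ≤ i → IdUpTo N (F (suc i))) →
  ∀ h → ⟦ prod F N ⟧ h ≈[ N ] ⟦ prod F (N * suc d) ⟧ h
prod-pad-* N d F F-id h m m≤N =
  sym (subst (λ j → ⟦ prod F j ⟧ h m ≡ ⟦ prod F N ⟧ h m)
             (trans (+-comm (N * d) N) (sym (*-suc N d)))
             (prod-pad N F N (N * d) F-id h m m≤N))

multiplesOf : ℕ → (ℕ → Op) → ℕ → Op
multiplesOf d G k = when (divᵇ d k) (G k)

prod-multiplesOf : ∀ d G m →
  prod (multiplesOf (suc d) G) (m * suc d) ≈ₒ prod (λ j → G (j * suc d)) m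
prod-multiplesOf d G zero    h n = refl
prod-multiplesOf d G (suc m) h n = begin
  ⟦ top ⟧ (⟦ prod (multiplesOf (suc d) G) (d + m * suc d) ⟧ h) n
    ≡⟨ ⟦⟧-cong top (λ n' → trans (prod-skip _ (m * suc d) d nonMultiple h n')
                                  (prod-multiplesOf d G m h n')) n ⟩
  ⟦ top ⟧ (⟦ prod (λ j → G (j * suc d)) m ⟧ h) n
    ≡⟨ when-true (G (suc m * suc d)) (cong (_≡ᵇ 0) (m*n%n≡0 (suc m) (suc d))) _ n ⟩
  ⟦ G (suc m * suc d) ⟧ (⟦ prod (λ j → G (j * suc d)) m ⟧ h) n
    ∎
  where
  open ≡-Reasoning
  top = multiplesOf (suc d) G (suc m * suc d)
  nonMultiple : ∀ i → i < d → multiplesOf (suc d) G (suc i + m * suc d) ≈ₒ idₒ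
  nonMultiple i i<d = when-false (G _)
    (cong (_≡ᵇ 0) (trans ([m+kn]%n≡m%n (suc i) m (suc d)) (m<n⇒m%n≡m (s≤s i<d))))

prod-multiplesOf-≈ : ∀ N d G → (∀ k → N < k → IdUpTo N (G k)) → ∀ h →
  ⟦ prod (multiplesOf (suc d) G) N ⟧ h ≈[ N ] ⟦ prod (λ j → G (j * suc d)) N ⟧ h
prod-multiplesOf-≈ N d G G-id h m m≤N =
  trans (prod-pad-* N d (multiplesOf (suc d) G) pad h m m≤N) (prod-multiplesOf d G N h m)
  where
  pad : ∀ i → N ≤ i → IdUpTo N (multiplesOf (suc d) G (suc i))
  pad i N≤i = when-IdUpTo N (divᵇ (suc d) (suc i)) (G-id (suc i) (s≤s N≤i))


-- Euler's identity

n+n≡n*2 : ∀ n → n + n ≡ n * 2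
n+n≡n*2 = solve-∀

E-split : ∀ k → Eₒ (suc k) ≈ₒ Aₒ (suc k) ⊙ Eₒ (suc k * 2)
E-split k h = sym ∘ E-unique k h (A d X) λ n → begin
  X n + shift d X n
    ≡⟨ cong (_+ shift d X n) (E-unfold _ h n) ⟩
  (h n + shift 2d X n) + shift d X n
    ≡⟨ +-assoc (h n) _ _ ⟩
  h n + (shift 2d X n + shift d X n)
    ≡⟨ cong (h n +_) (+-comm _ (shift d X n)) ⟩
  h n + (shift d X n + shift 2d X n)
    ≡⟨ cong (λ x → h n + (shift d X n + x)) (twice n) ⟨
  h n + (shift d X n + shift d (shift d X) n)
    ≡⟨ cong (h n +_) (shift-⊕ d X _ n) ⟨
  h n + shift d (A d X) n
    ∎
  where
  open ≡-Reasoning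
  d = suc k
  2d = suc k * 2
  X = E 2d h
  twice : shift d (shift d X) ≗ shift 2d X
  twice n = trans (shift-shift d d X n) (cong (λ j → shift j X n) (n+n≡n*2 d))

oddE : ℕ → Op
oddE k = when (not (divᵇ 2 k)) (Eₒ k)

oddE-pair : ∀ m → oddE (suc m * 2) ⊙ oddE (suc (m * 2)) ≈ₒ Eₒ (suc (m * 2))
oddE-pair m h n =
  trans (when-false (Eₒ (suc m * 2)) (cong (not ∘ (_≡ᵇ 0)) (m*n%n≡0 (suc m) 2)) _ n)
        (when-true (Eₒ (suc (m * 2))) (cong (not ∘ (_≡ᵇ 0)) ([m+kn]%n≡m%n 1 m 2)) h n)

-- E_{2k} for m < k ≤ 2m
evenTail : ℕ → Op
evenTail m = prod (λ i → Eₒ ((i + m) * 2)) m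

-- From m to m + 1 the range (m, 2m] gains 2m + 1 and loses m + 1.
evenTail-step : ∀ m → Eₒ (suc (m * 2) * 2) ⊙ evenTail m
  ≈ₒ prod (λ i → Eₒ ((i + suc m) * 2)) m ⊙ Eₒ (suc m * 2)
evenTail-step m h n = begin
  ⟦ Eₒ (suc (m * 2) * 2) ⊙ evenTail m ⟧ h n
    ≡⟨ cong (λ j → ⟦ Eₒ (suc j * 2) ⊙ evenTail m ⟧ h n) (n+n≡n*2 m) ⟨
  ⟦ prod (λ i → Eₒ ((i + m) * 2)) (suc m) ⟧ h n
    ≡⟨ prod-peel (λ i → Eₒ ((i + m) * 2)) m h n ⟩
  ⟦ prod (λ i → Eₒ ((suc i + m) * 2)) m ⊙ Eₒ (suc m * 2) ⟧ h n
    ≡⟨ prod-cong _ _ m reindex (E (suc m * 2) h) n ⟨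
  ⟦ prod (λ i → Eₒ ((i + suc m) * 2)) m ⊙ Eₒ (suc m * 2) ⟧ h n
    ∎
  where
  open ≡-Reasoning
  reindex : ∀ i → i < m → Eₒ ((suc i + suc m) * 2) ≈ₒ Eₒ ((suc (suc i) + m) * 2)
  reindex i _ h' n' = cong (λ j → E (j * 2) h' n') (+-suc (suc i) m)

euler-exact : ∀ m → prod oddE (m * 2) ≈ₒ prod Aₒ (m * 2) ⊙ evenTail m
euler-exact zero    h n = refl
euler-exact (suc m) h n = begin
  ⟦ oddE k₂ ⊙ oddE k₁ ⊙ prod oddE (m * 2) ⟧ h n
    ≡⟨ oddE-pair m _ n ⟩
  E k₁ (⟦ prod oddE (m * 2) ⟧ h) n
    ≡⟨ ⟦⟧-cong (Eₒ k₁) (euler-exact m h) n ⟩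
  ⟦ Eₒ k₁ ⊙ PA ⊙ evenTail m ⟧ h n
    ≡⟨ E-split (m * 2) _ n ⟩
  ⟦ Aₒ k₁ ⊙ Eₒ (k₁ * 2) ⊙ PA ⊙ evenTail m ⟧ h n
    ≡⟨ ⟦⟧-cong (Aₒ k₁) (⟦⟧-comm (Eₒ (k₁ * 2)) PA _) n ⟩
  ⟦ Aₒ k₁ ⊙ PA ⊙ Eₒ (k₁ * 2) ⊙ evenTail m ⟧ h n
    ≡⟨ ⟦⟧-cong (Aₒ k₁ ⊙ PA) (evenTail-step m h) n ⟩
  ⟦ Aₒ k₁ ⊙ PA ⊙ rest ⊙ Eₒ k₂ ⟧ h n
    ≡⟨ ⟦⟧-cong (Aₒ k₁ ⊙ PA ⊙ rest) (E-split k₁ h) n ⟩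
  ⟦ Aₒ k₁ ⊙ PA ⊙ rest ⊙ Aₒ k₂ ⊙ Eₒ (k₂ * 2) ⟧ h n
    ≡⟨ ⟦⟧-comm (Aₒ k₁ ⊙ PA ⊙ rest) (Aₒ k₂ ⊙ Eₒ (k₂ * 2)) h n ⟩
  ⟦ Aₒ k₂ ⊙ Eₒ (k₂ * 2) ⊙ Aₒ k₁ ⊙ PA ⊙ rest ⟧ h n
    ≡⟨ ⟦⟧-cong (Aₒ k₂) (⟦⟧-comm (Eₒ (k₂ * 2)) (Aₒ k₁ ⊙ PA) _) n ⟩
  ⟦ Aₒ k₂ ⊙ Aₒ k₁ ⊙ PA ⊙ Eₒ (k₂ * 2) ⊙ rest ⟧ h n
    ≡⟨ cong (λ j → ⟦ Aₒ k₂ ⊙ Aₒ k₁ ⊙ PA ⊙ Eₒ (j * 2) ⊙ rest ⟧ h n)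
            (n+n≡n*2 (suc m)) ⟨
  ⟦ prod Aₒ (suc m * 2) ⊙ evenTail (suc m) ⟧ h n
    ∎
  where
  open ≡-Reasoning
  k₁ = suc (m * 2)
  k₂ = suc k₁
  PA = prod Aₒ (m * 2)
  rest = prod (λ i → Eₒ ((i + suc m) * 2)) m

euler : ∀ N h → ⟦ prod oddE N ⟧ h ≈[ N ] ⟦ prod Aₒ N ⟧ h
euler N h m m≤N = begin
  ⟦ prod oddE N ⟧ h m
    ≡⟨ prod-pad-* N 1 oddE oddE-id h m m≤N ⟩
  ⟦ prod oddE (N * 2) ⟧ h m
    ≡⟨ euler-exact N h m ⟩
  ⟦ prod Aₒ (N * 2) ⟧ (⟦ evenTail N ⟧ h) m
    ≡⟨ ⟦⟧-≈ (prod Aₒ (N * 2)) N evenTail-id m m≤N ⟩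
  ⟦ prod Aₒ (N * 2) ⟧ h m
    ≡⟨ prod-pad-* N 1 Aₒ A-id h m m≤N ⟨
  ⟦ prod Aₒ N ⟧ h m
    ∎
  where
  open ≡-Reasoning
  oddE-id : ∀ i → N ≤ i → IdUpTo N (oddE (suc i))
  oddE-id i N≤i = when-IdUpTo N (not (divᵇ 2 (suc i))) (E-IdUpTo N (suc i) (s≤s N≤i))
  A-id : ∀ i → N ≤ i → IdUpTo N (Aₒ (suc i))
  A-id i N≤i = A-IdUpTo N (suc i) (s≤s N≤i)
  evenTail-id : ⟦ evenTail N ⟧ h ≈[ N ] h
  evenTail-id = prod-IdUpTo N _ N (λ i _ → E-IdUpTo N _ (m<n⇒m<n*o 2 (m<n+m N {suc i} z<s))) h


-- Factors of common multiplicity patterns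

factor-all : ∀ k g h → (∀ c → g c ≡ true) → factor (suc k) g h ≗ E (suc k) h
factor-all k g h always = factor-cong (suc k) h always

factor-only0 : ∀ k g h → g 0 ≡ true → (∀ c → g (suc c) ≡ false) →
  factor (suc k) g h ≗ h
factor-only0 k g h g0 never n = begin
  factor (suc k) g h n
    ≡⟨ factor-unfold k g h n ⟩
  g 0 · h n + shift (suc k) (factor (suc k) (g ∘ suc) h) n
    ≡⟨ cong₂ _+_ (cong (_· h n) g0) rest≡0 ⟩
  h n + 0
    ≡⟨ +-identityʳ (h n) ⟩
  h n
    ∎
  where
  open ≡-Reasoning
  rest≡0 : shift (suc k) (factor (suc k) (g ∘ suc) h) n ≡ 0
  rest≡0 = trans (shift-cong (suc k) (factor-never (suc k) (g ∘ suc) h never) n)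
                 (shift-0 (suc k) n)

factor-only01 : ∀ k g h → g 0 ≡ true → g 1 ≡ true → (∀ c → g (2 + c) ≡ false) →
  factor (suc k) g h ≗ A (suc k) h
factor-only01 k g h g0 g1 never n = trans (factor-unfold k g h n)
  (cong₂ _+_ (cong (_· h n) g0) (shift-cong (suc k) (factor-only0 k (g ∘ suc) h g1 never) n))

factor-when : ∀ k b g h → g 0 ≡ true → (∀ c → g (suc c) ≡ b) →
  factor (suc k) g h ≗ ⟦ when b (Eₒ (suc k)) ⟧ h
factor-when k true  g h g0 g+ = factor-all k g h λ { zero → g0 ; (suc c) → g+ c }
factor-when k false g h g0 g+ = factor-only0 k g h g0 g+

factor-A⊙when : ∀ k b g h → g 0 ≡ true → g 1 ≡ true → (∀ c → g (2 + c) ≡ b) →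
  factor (suc k) g h ≗ ⟦ Aₒ (suc k) ⊙ when b (Eₒ (suc k * 2)) ⟧ h
factor-A⊙when k true  g h g0 g1 g+ n =
  trans (factor-all k g h (λ { zero → g0 ; (suc zero) → g1 ; (suc (suc c)) → g+ c }) n)
        (E-split k h n)
factor-A⊙when k false g h g0 g1 g+   = factor-only01 k g h g0 g1 g+

factor-split : ∀ k p g h → factor (suc k) g h
  ≗ factor (suc k) (λ c → (c <ᵇ p) ∧ g c) h
    ⊕ shift (p * suc k) (factor (suc k) (g ∘ (p +_)) h)
factor-split k zero    g h n =
  sym (cong (_+ factor (suc k) g h n) (factor-never (suc k) _ h (λ _ → refl) n))
factor-split k (suc p) g h n = begin
  factor d g h n
    ≡⟨ factor-unfold k g h n ⟩
  g 0 · h n + shift d (factor d (g ∘ suc) h) n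
    ≡⟨ cong (g 0 · h n +_) (shift-cong d (factor-split k p (g ∘ suc) h) n) ⟩
  g 0 · h n + shift d (factor d low h ⊕ shift (p * d) high) n
    ≡⟨ cong (g 0 · h n +_) (shift-⊕ d _ _ n) ⟩
  g 0 · h n + (shift d (factor d low h) n + shift d (shift (p * d) high) n)
    ≡⟨ +-assoc (g 0 · h n) _ _ ⟨
  (g 0 · h n + shift d (factor d low h) n) + shift d (shift (p * d) high) n
    ≡⟨ cong₂ _+_ (factor-unfold k (λ c → (c <ᵇ suc p) ∧ g c) h n)
                 (sym (shift-shift d (p * d) high n)) ⟨
  factor d (λ c → (c <ᵇ suc p) ∧ g c) h n + shift (suc p * d) high n
    ∎
  where
  open ≡-Reasoning
  d = suc k
  low = λ c → (c <ᵇ p) ∧ g (suc c)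
  high = factor d (g ∘ (suc p +_)) h

factor-periodic : ∀ k p g h → (∀ c → g (suc p + c) ≡ g c) →
  factor (suc k) g h ≗ E (suc p * suc k) (factor (suc k) (λ c → (c <ᵇ suc p) ∧ g c) h)
factor-periodic k p g h periodic = E-unique (k + p * suc k) _ (factor (suc k) g h) λ n →
  trans (factor-split k (suc p) g h n)
        (cong (factor (suc k) (λ c → (c <ᵇ suc p) ∧ g c) h n +_)
              (shift-cong (suc p * suc k) (factor-cong (suc k) h periodic) n))


-- Counting partitions by multiplicities

T⇒≡true : ∀ {b} → T b → b ≡ true
T⇒≡true {true} _ = refl

¬T⇒≡false : ∀ {b} → ¬ T b → b ≡ false
¬T⇒≡false {true}  ¬t = contradiction _ ¬t
¬T⇒≡false {false} _  = refl

count : {X : Set} → (X → Bool) → List X → ℕ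
count R []       = 0
count R (x ∷ xs) = R x · 1 + count R xs

length-filter≡count : ∀ {X : Set} (R : X → Bool) xs →
  length (filter (T? ∘ R) xs) ≡ count R xs
length-filter≡count R []       = refl
length-filter≡count R (x ∷ xs) with R x
... | true  = cong suc (length-filter≡count R xs)
... | false = length-filter≡count R xs

count-++ : ∀ {X : Set} (R : X → Bool) xs ys → count R (xs ++ ys) ≡ count R xs + count R ys
count-++ R []       ys = refl
count-++ R (x ∷ xs) ys =
  trans (cong (R x · 1 +_) (count-++ R xs ys)) (sym (+-assoc (R x · 1) _ _))

count-map : ∀ {X Y : Set} (R : Y → Bool) (f : X → Y) xs →
  count R (map f xs) ≡ count (R ∘ f) xs
count-map R f []       = refl
count-map R f (x ∷ xs) = cong (R (f x) · 1 +_) (count-map R f xs)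

count-cong-All : ∀ {X : Set} {P : X → Set} (R R' : X → Bool) {xs} → All P xs →
  (∀ x → P x → R x ≡ R' x) → count R xs ≡ count R' xs
count-cong-All R R' []         R≡R' = refl
count-cong-All R R' (px ∷ pxs) R≡R' =
  cong₂ (λ b c → b · 1 + c) (R≡R' _ px) (count-cong-All R R' pxs R≡R')

count-cong : ∀ {X : Set} {R R' : X → Bool} xs → (∀ x → R x ≡ R' x) →
  count R xs ≡ count R' xs
count-cong []       R≡R' = refl
count-cong (x ∷ xs) R≡R' = cong₂ (λ b c → b · 1 + c) (R≡R' x) (count-cong xs R≡R')

count-∧ˡ : ∀ {X : Set} b (R : X → Bool) xs →
  count (λ x → b ∧ R x) xs ≡ b · count R xs
count-∧ˡ true  R xs       = refl
count-∧ˡ false R []       = refl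
count-∧ˡ false R (x ∷ xs) = count-∧ˡ false R xs

Σ< : ℕ → (ℕ → ℕ) → ℕ
Σ< zero    g = 0
Σ< (suc N) g = g 0 + Σ< N (g ∘ suc)

Σ<-cong : ∀ N {g g'} → (∀ k → k < N → g k ≡ g' k) → Σ< N g ≡ Σ< N g'
Σ<-cong zero    g≡g' = refl
Σ<-cong (suc N) g≡g' =
  cong₂ _+_ (g≡g' 0 z<s) (Σ<-cong N (λ k k<N → g≡g' (suc k) (s≤s k<N)))

Σ<-+ : ∀ N g g' → Σ< N (λ k → g k + g' k) ≡ Σ< N g + Σ< N g'
Σ<-+ zero    g g' = refl
Σ<-+ (suc N) g g' =
  trans (cong (g 0 + g' 0 +_) (Σ<-+ N (g ∘ suc) (g' ∘ suc))) (+-interchange (g 0) (g' 0) _ _)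

Σ<-· : ∀ N b g → Σ< N (λ k → b · g k) ≡ b · Σ< N g
Σ<-· zero    b g = sym (·-zeroʳ b)
Σ<-· (suc N) b g =
  trans (cong (b · g 0 +_) (Σ<-· N b (g ∘ suc))) (sym (·-distribˡ-+ b _ _))

Σ<-0 : ∀ N → Σ< N (λ _ → 0) ≡ 0
Σ<-0 zero    = refl
Σ<-0 (suc N) = Σ<-0 N

Σ<-single : ∀ N j y → Σ< N (λ k → (k ≡ᵇ j) · y) ≡ (j <ᵇ N) · y
Σ<-single zero    j       y = refl
Σ<-single (suc N) zero    y = trans (cong (y +_) (Σ<-0 N)) (+-identityʳ y)
Σ<-single (suc N) (suc j) y = Σ<-single N j y

count-concatMap-filter : ∀ {X Y : Set} (R : Y → Bool) (c : X → Bool) (F : X → List Y)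
  g N →
  count R (concatMap F (filter (T? ∘ c) (applyUpTo g N)))
  ≡ Σ< N (λ k → c (g k) · count R (F (g k)))
count-concatMap-filter R c F g zero = refl
count-concatMap-filter R c F g (suc N) with c (g 0)
... | true  = trans (count-++ R (F (g 0)) _)
                    (cong (count R (F (g 0)) +_) (count-concatMap-filter R c F (g ∘ suc) N))
... | false = count-concatMap-filter R c F (g ∘ suc) N

All-concatMap-filter : ∀ {X Y : Set} (P : Y → Set) (c : X → Bool) (F : X → List Y) xs →
  (∀ x → T (c x) → All P (F x)) → All P (concatMap F (filter (T? ∘ c) xs))
All-concatMap-filter P c F []       PF = []
All-concatMap-filter P c F (x ∷ xs) PF with c x in eq
... | true  = ++⁺ (PF x (subst T (sym eq) _)) (All-concatMap-filter P c F xs PF)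
... | false = All-concatMap-filter P c F xs PF

partitionsBounded-≤ : ∀ f n m → All (All (_≤ m)) (partitionsBounded f n m)
partitionsBounded-≤ f       zero    m = [] ∷ []
partitionsBounded-≤ zero    (suc n) m = []
partitionsBounded-≤ (suc f) (suc n) m = All-concatMap-filter _ _ _ (upTo (suc n)) bounded
  where
  bounded : ∀ k → T ((suc k ≤ᵇ suc n) ∧ (suc k ≤ᵇ m)) →
    All (All (_≤ m)) (map (suc k ∷_) (partitionsBounded f (n ∸ k) (suc k)))
  bounded k t = map⁺ (All.map (λ ≤k → k<m ∷ All.map (λ x≤k → ≤-trans x≤k k<m) ≤k)
                              (partitionsBounded-≤ f (n ∸ k) (suc k)))
    where
    k<m : suc k ≤ m
    k<m = ≤ᵇ⇒≤ (suc k) m (proj₂ (Equivalence.to T-∧ t))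

-- partitions of n + 1 with largest part k + 1, counted by R
countLargest : (List ℕ → Bool) → ℕ → ℕ → ℕ → ℕ
countLargest R f n k = count (R ∘ (suc k ∷_)) (partitionsBounded f (n ∸ k) (suc k))

count-partitionsBounded-suc : ∀ R f n m → count R (partitionsBounded (suc f) (suc n) m)
  ≡ Σ< (suc n) (λ k → (suc k ≤ᵇ m) · countLargest R f n k)
count-partitionsBounded-suc R f n m =
  trans (count-concatMap-filter R c _ (λ k → k) (suc n))
        (Σ<-cong (suc n) λ k k≤n → cong₂ (λ b x → (b ∧ (suc k ≤ᵇ m)) · x)
          (T⇒≡true (≤⇒≤ᵇ k≤n))
          (count-map R (suc k ∷_) (partitionsBounded f (n ∸ k) (suc k))))
  where
  c = λ k → (suc k ≤ᵇ suc n) ∧ (suc k ≤ᵇ m)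

mult-here : ∀ k p → mult k (k ∷ p) ≡ suc (mult k p)
mult-here k p rewrite T⇒≡true (≡⇒≡ᵇ k k refl) = refl

mult-there : ∀ {x k} p → x ≢ k → mult k (x ∷ p) ≡ mult k p
mult-there {x} {k} p x≢k rewrite ¬T⇒≡false (x≢k ∘ ≡ᵇ⇒≡ x k) = refl

mult-replicate-++ : ∀ k c q → mult k (replicate c k ++ q) ≡ c + mult k q
mult-replicate-++ k zero    q = refl
mult-replicate-++ k (suc c) q = trans (mult-here k _) (cong suc (mult-replicate-++ k c q))

mult-replicate-++-other : ∀ {k x} c q → k ≢ x → mult x (replicate c k ++ q) ≡ mult x q
mult-replicate-++-other zero    q k≢x = refl
mult-replicate-++-other (suc c) q k≢x =
  trans (mult-there _ k≢x) (mult-replicate-++-other c q k≢x)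

mult-absent : ∀ k q → All (_< k) q → mult k q ≡ 0
mult-absent k []      []          = refl
mult-absent k (x ∷ q) (x<k ∷ q<k) = trans (mult-there q (<⇒≢ x<k)) (mult-absent k q q<k)

all-++ : ∀ {X : Set} (g : X → Bool) xs ys → all g (xs ++ ys) ≡ all g xs ∧ all g ys
all-++ g []       ys = refl
all-++ g (x ∷ xs) ys = trans (cong (g x ∧_) (all-++ g xs ys)) (sym (∧-assoc (g x) _ _))

all-replicate : ∀ {X : Set} (g : X → Bool) c x → all g (replicate (suc c) x) ≡ g x
all-replicate g zero    x = ∧-identityʳ (g x)
all-replicate g (suc c) x = trans (cong (g x ∧_) (all-replicate g c x)) (∧-idem (g x))

all-cong-All : ∀ {X : Set} {P : X → Set} (g g' : X → Bool) {xs} → All P xs →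
  (∀ x → P x → g x ≡ g' x) → all g xs ≡ all g' xs
all-cong-All g g' []         g≡g' = refl
all-cong-All g g' (px ∷ pxs) g≡g' = cong₂ _∧_ (g≡g' _ px) (all-cong-All g g' pxs g≡g')

satisfies : (ℕ → ℕ → Bool) → List ℕ → Bool
satisfies Q p = all (λ k → Q k (mult k p)) p

-- A part that does not occur imposes no condition.
allowed : (ℕ → ℕ → Bool) → ℕ → ℕ → Bool
allowed Q k zero    = true
allowed Q k (suc c) = Q k (suc c)

satisfies-replicate-++ : ∀ Q k c q → All (_< k) q →
  satisfies Q (replicate c k ++ q) ≡ allowed Q k c ∧ satisfies Q q
satisfies-replicate-++ Q k zero    q q<k = refl
satisfies-replicate-++ Q k (suc c) q q<k = begin
  all g (replicate (suc c) k ++ q)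
    ≡⟨ all-++ g (replicate (suc c) k) q ⟩
  all g (replicate (suc c) k) ∧ all g q
    ≡⟨ cong (_∧ all g q) (all-replicate g c k) ⟩
  Q k (mult k (replicate (suc c) k ++ q)) ∧ all g q
    ≡⟨ cong₂ (λ c' b → Q k c' ∧ b) mult-k others ⟩
  Q k (suc c) ∧ satisfies Q q
    ∎
  where
  open ≡-Reasoning
  g = λ x → Q x (mult x (replicate (suc c) k ++ q))
  mult-k : mult k (replicate (suc c) k ++ q) ≡ suc c
  mult-k = trans (mult-replicate-++ k (suc c) q)
                 (trans (cong (suc c +_) (mult-absent k q q<k)) (+-identityʳ (suc c)))
  others : all g q ≡ satisfies Q q
  others = all-cong-All g _ q<k λ x x<k →
    cong (Q x) (mult-replicate-++-other (suc c) q (<⇒≢ x<k ∘ sym))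

replicate-++-∷ : ∀ c (x : ℕ) p → replicate c x ++ x ∷ p ≡ replicate (suc c) x ++ p
replicate-++-∷ zero    x p = refl
replicate-++-∷ (suc c) x p = cong (x ∷_) (replicate-++-∷ c x p)

-- partitions of n with parts ≤ m, counted together with c further parts m
countPadded : (ℕ → ℕ → Bool) → ℕ → ℕ → ℕ → ℕ → ℕ
countPadded Q c f n m = count (satisfies Q ∘ (replicate c m ++_)) (partitionsBounded f n m)

countPadded-term : ∀ Q c f n m k →
  (suc k ≤ᵇ suc m) · countLargest (satisfies Q ∘ (replicate c (suc m) ++_)) f n k
  ≡ allowed Q (suc m) c · ((suc k ≤ᵇ m) · countLargest (satisfies Q) f n k)
    + (k ≡ᵇ m) · countPadded Q (suc c) f (n ∸ m) (suc m)
countPadded-term Q c f n m k with <-cmp k m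
... | tri< k<m k≢m _
  rewrite T⇒≡true (≤⇒≤ᵇ (m<n⇒m<1+n k<m)) | T⇒≡true (≤⇒≤ᵇ k<m)
        | ¬T⇒≡false (k≢m ∘ ≡ᵇ⇒≡ k m) =
  trans (trans (count-cong-All _ (λ p → a ∧ satisfies Q (suc k ∷ p))
                               (partitionsBounded-≤ f n-k (suc k))
                               (λ p → satisfies-replicate-++ Q (suc m) c (suc k ∷ p) ∘ below))
               (count-∧ˡ a _ (partitionsBounded f n-k (suc k))))
        (sym (+-identityʳ _))
  where
  a = allowed Q (suc m) c
  n-k = n ∸ k
  below : ∀ {p} → All (_≤ suc k) p → All (_< suc m) (suc k ∷ p)
  below p≤k = s≤s k<m ∷ All.map (λ x≤k → s≤s (≤-trans x≤k k<m)) p≤k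
... | tri≈ _ refl _
  rewrite T⇒≡true (≤⇒≤ᵇ (≤-refl {suc k}))
        | ¬T⇒≡false (<-irrefl refl ∘ ≤ᵇ⇒≤ (suc k) k) =
  trans (count-cong (partitionsBounded f (n ∸ k) (suc k))
                    (cong (satisfies Q) ∘ replicate-++-∷ c (suc k)))
        (sym (cong₂ (λ x b → x + b · countPadded Q (suc c) f (n ∸ k) (suc k))
                    (·-zeroʳ (allowed Q (suc k) c)) (T⇒≡true (≡⇒≡ᵇ k k refl))))
... | tri> _ k≢m m<k
  rewrite ¬T⇒≡false (<-irrefl refl ∘ <-≤-trans m<k ∘ ≤-pred ∘ ≤ᵇ⇒≤ (suc k) (suc m))
        | ¬T⇒≡false (<-irrefl refl ∘ <-trans m<k ∘ ≤ᵇ⇒≤ (suc k) m)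
        | ¬T⇒≡false (k≢m ∘ ≡ᵇ⇒≡ k m) =
  sym (cong (_+ 0) (·-zeroʳ (allowed Q (suc m) c)))

countPadded-rec : ∀ Q c f n m → countPadded Q c (suc f) (suc n) (suc m)
  ≡ allowed Q (suc m) c · countPadded Q 0 (suc f) (suc n) m
    + (m <ᵇ suc n) · countPadded Q (suc c) f (n ∸ m) (suc m)
countPadded-rec Q c f n m = begin
  countPadded Q c (suc f) (suc n) (suc m)
    ≡⟨ count-partitionsBounded-suc R f n (suc m) ⟩
  Σ< (suc n) (λ k → (suc k ≤ᵇ suc m) · countLargest R f n k)
    ≡⟨ Σ<-cong (suc n) (λ k _ → countPadded-term Q c f n m k) ⟩
  Σ< (suc n) (λ k → a · w k + (k ≡ᵇ m) · y)
    ≡⟨ Σ<-+ (suc n) (λ k → a · w k) (λ k → (k ≡ᵇ m) · y) ⟩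
  Σ< (suc n) (λ k → a · w k) + Σ< (suc n) (λ k → (k ≡ᵇ m) · y)
    ≡⟨ cong₂ _+_ (Σ<-· (suc n) a w) (Σ<-single (suc n) m y) ⟩
  a · Σ< (suc n) w + (m <ᵇ suc n) · y
    ≡⟨ cong (λ x → a · x + (m <ᵇ suc n) · y)
            (count-partitionsBounded-suc (satisfies Q) f n m) ⟨
  a · countPadded Q 0 (suc f) (suc n) m + (m <ᵇ suc n) · y
    ∎
  where
  open ≡-Reasoning
  R = satisfies Q ∘ (replicate c (suc m) ++_)
  a = allowed Q (suc m) c
  y = countPadded Q (suc c) f (n ∸ m) (suc m)
  w : ℕ → ℕ
  w k = (suc k ≤ᵇ m) · countLargest (satisfies Q) f n k

genFun : (ℕ → ℕ → Bool) → ℕ → Series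
genFun Q zero    = δ
genFun Q (suc m) = factor (suc m) (allowed Q (suc m)) (genFun Q m)

count≡genFun : ∀ Q f n m → n ≤ f → countPadded Q 0 f n m ≡ genFun Q m n
countPadded≡factor : ∀ Q c f n m → n ≤ f →
  countPadded Q c f n (suc m) ≡ factor (suc m) (λ j → allowed Q (suc m) (j + c)) (genFun Q m) n

count≡genFun Q f       zero    zero    _   = refl
count≡genFun Q (suc f) (suc n) zero    _   =
  trans (count-partitionsBounded-suc (satisfies Q) f n zero) (Σ<-0 (suc n))
count≡genFun Q f       n       (suc m) n≤f =
  trans (countPadded≡factor Q 0 f n m n≤f)
        (factor-cong (suc m) _ (cong (allowed Q (suc m)) ∘ +-identityʳ) n)

countPadded≡factor Q c f zero m _ =
  cong₂ (λ b x → b · x + 0)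
        (trans (satisfies-replicate-++ Q (suc m) c [] []) (∧-identityʳ _))
        (count≡genFun Q f zero m z≤n)
countPadded≡factor Q c (suc f) (suc n) m (s≤s n≤f) = begin
  countPadded Q c (suc f) (suc n) (suc m)
    ≡⟨ countPadded-rec Q c f n m ⟩
  a · countPadded Q 0 (suc f) (suc n) m + (m <ᵇ suc n) · countPadded Q (suc c) f (n ∸ m) (suc m)
    ≡⟨ cong₂ (λ x y → a · x + (m <ᵇ suc n) · y)
             (count≡genFun Q (suc f) (suc n) m (s≤s n≤f)) next ⟩
  a · genFun Q m (suc n) + (m <ᵇ suc n) · X (n ∸ m)
    ≡⟨ cong (a · genFun Q m (suc n) +_) (shift-· m X n) ⟨
  a · genFun Q m (suc n) + shift (suc m) X (suc n)
    ≡⟨ factor-unfold m g (genFun Q m) (suc n) ⟨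
  factor (suc m) g (genFun Q m) (suc n)
    ∎
  where
  open ≡-Reasoning
  g = λ j → allowed Q (suc m) (j + c)
  a = g 0
  X = factor (suc m) (g ∘ suc) (genFun Q m)
  next : countPadded Q (suc c) f (n ∸ m) (suc m) ≡ X (n ∸ m)
  next = trans (countPadded≡factor Q (suc c) f (n ∸ m) m (≤-trans (m∸n≤m n m) n≤f))
               (factor-cong (suc m) _ (λ j → cong (allowed Q (suc m)) (+-suc j c)) (n ∸ m))

countPartitions≡genFun : ∀ Q n → countPartitions (satisfies Q) n ≡ genFun Q n n
countPartitions≡genFun Q n =
  trans (length-filter≡count (satisfies Q) (partitions n)) (count≡genFun Q n n n ≤-refl)

genFun≗prod : ∀ Q F →
  (∀ k h → factor (suc k) (allowed Q (suc k)) h ≗ ⟦ F (suc k) ⟧ h) →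
  ∀ m → genFun Q m ≗ ⟦ prod F m ⟧ δ
genFun≗prod Q F factor≗F zero    n = refl
genFun≗prod Q F factor≗F (suc m) n =
  trans (factor-≈ (suc m) {allowed Q (suc m)} n (λ _ → refl)
                  (λ n' _ → genFun≗prod Q F factor≗F m n'))
        (factor≗F m (⟦ prod F m ⟧ δ) n)


-- The three partition functions

common : ℕ → ℕ → Op
common s n = prod Aₒ n ⊙ prod (λ j → Eₒ (j * s)) n

divᵇ-+ : ∀ d a → divᵇ (suc d) (suc d + a) ≡ divᵇ (suc d) a
divᵇ-+ d a =
  cong (_≡ᵇ 0) (trans (cong (_% suc d) (+-comm (suc d) a)) ([m+n]%n≡m%n a (suc d)))

divᵇ-< : ∀ {d x} → suc x < suc d → divᵇ (suc d) (suc x) ≡ false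
divᵇ-< x<d = cong (_≡ᵇ 0) (m<n⇒m%n≡m x<d)

M-condition C-condition D-condition : ℕ → ℕ → ℕ → Bool
M-condition s k c = divᵇ s c ∨ divᵇ s (c ∸ 1)
C-condition s k c = not (not (modℕ s k ≡ᵇ 0) ∧ divᵇ 2 (modℕ s k))
D-condition t k c = (c ≤ᵇ 1) ∨ divᵇ t k

M-factor : ∀ p k h → factor (suc k) (allowed (M-condition (2 + p)) (suc k)) h
  ≗ ⟦ Aₒ (suc k) ⊙ Eₒ ((2 + p) * suc k) ⟧ h
M-factor p k h n = begin
  factor d g h n
    ≡⟨ factor-periodic k (suc p) g h periodic n ⟩
  E (s * d) (factor d g<s h) n
    ≡⟨ ⟦⟧-cong (Eₒ (s * d)) (factor-only01 k g<s h refl refl beyond) n ⟩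
  E (s * d) (A d h) n
    ≡⟨ ⟦⟧-comm (Eₒ (s * d)) (Aₒ d) h n ⟩
  A d (E (s * d) h) n
    ∎
  where
  open ≡-Reasoning
  s = 2 + p
  d = suc k
  g = allowed (M-condition s) d
  g<s = λ c → (c <ᵇ s) ∧ g c
  periodic : ∀ c → g (s + c) ≡ g c
  periodic zero    = cong (_∨ divᵇ s (s + 0 ∸ 1)) (divᵇ-+ (suc p) 0)
  periodic (suc c) = cong₂ _∨_ (divᵇ-+ (suc p) (suc c))
                               (trans (cong (divᵇ s ∘ suc) (+-suc p c)) (divᵇ-+ (suc p) c))
  beyond : ∀ c → g<s (2 + c) ≡ false
  beyond c with c <ᵇ p in c<ᵇp
  ... | true  = cong₂ _∨_ (divᵇ-< (s≤s (s≤s c<p))) (divᵇ-< (s≤s (s≤s (<⇒≤ c<p))))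
    where
    c<p : c < p
    c<p = <ᵇ⇒< c p (subst T (sym c<ᵇp) _)
  ... | false = refl

M≡common : ∀ p n → M (2 + p) n ≡ ⟦ common (2 + p) n ⟧ δ n
M≡common p n = begin
  M s n
    ≡⟨ countPartitions≡genFun (M-condition s) n ⟩
  genFun (M-condition s) n n
    ≡⟨ genFun≗prod _ F (M-factor p) n n ⟩
  ⟦ prod F n ⟧ δ n
    ≡⟨ prod-⊙ Aₒ (λ k → Eₒ (s * k)) n δ n ⟩
  ⟦ prod Aₒ n ⊙ prod (λ k → Eₒ (s * k)) n ⟧ δ n
    ≡⟨ ⟦⟧-cong (prod Aₒ n) (prod-cong _ _ n comm δ) n ⟩
  ⟦ common s n ⟧ δ n
    ∎
  where
  open ≡-Reasoning
  s = 2 + p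
  F = λ k → Aₒ k ⊙ Eₒ (s * k)
  comm : ∀ i → i < n → Eₒ (s * suc i) ≈ₒ Eₒ (suc i * s)
  comm i _ h n' = cong (λ j → E j h n') (*-comm s (suc i))

C-factor : ∀ s k h → factor (suc k) (allowed (C-condition s) (suc k)) h
  ≗ ⟦ when (C-condition s (suc k) 1) (Eₒ (suc k)) ⟧ h
C-factor s k h = factor-when k _ (allowed (C-condition s) (suc k)) h refl (λ _ → refl)

-- s is even, so no part is both odd and a multiple of s.
C-split : ∀ p → 2 ∣ suc p → ∀ k →
  when (C-condition (suc p) k 1) (Eₒ k) ≈ₒ oddE k ⊙ multiplesOf (suc p) Eₒ k
C-split p 2∣s k = split (k % suc p) (m∣n⇒o%n%m≡o%m 2 (suc p) k 2∣s)
  where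
  split : ∀ r → r % 2 ≡ k % 2 → when (not (not (r ≡ᵇ 0) ∧ (r % 2 ≡ᵇ 0))) (Eₒ k)
    ≈ₒ oddE k ⊙ when (r ≡ᵇ 0) (Eₒ k)
  split zero    r≡k rewrite sym r≡k = λ h n → refl
  split (suc r) r≡k rewrite r≡k     = λ h n → refl

C≡common : ∀ p → 2 ∣ suc p → ∀ n → C (suc p) n ≡ ⟦ common (suc p) n ⟧ δ n
C≡common p 2∣s n = begin
  C s n
    ≡⟨ countPartitions≡genFun (C-condition s) n ⟩
  genFun (C-condition s) n n
    ≡⟨ genFun≗prod _ F (C-factor s) n n ⟩
  ⟦ prod F n ⟧ δ n
    ≡⟨ prod-cong _ _ n split δ n ⟩
  ⟦ prod (λ k → oddE k ⊙ multiplesOf s Eₒ k) n ⟧ δ n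
    ≡⟨ prod-⊙ oddE (multiplesOf s Eₒ) n δ n ⟩
  ⟦ prod oddE n ⟧ Y n
    ≡⟨ euler n Y n ≤-refl ⟩
  ⟦ prod Aₒ n ⟧ Y n
    ≡⟨ ⟦⟧-≈ (prod Aₒ n) n Y≈ n ≤-refl ⟩
  ⟦ common s n ⟧ δ n
    ∎
  where
  open ≡-Reasoning
  s = suc p
  F = λ k → when (C-condition s k 1) (Eₒ k)
  split : ∀ i → i < n → F (suc i) ≈ₒ oddE (suc i) ⊙ multiplesOf s Eₒ (suc i)
  split i _ = C-split p 2∣s (suc i)
  Y = ⟦ prod (multiplesOf s Eₒ) n ⟧ δ
  Y≈ : Y ≈[ n ] ⟦ prod (λ j → Eₒ (j * s)) n ⟧ δ
  Y≈ = prod-multiplesOf-≈ n p Eₒ (E-IdUpTo n) δ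

D-factor : ∀ t k h → factor (suc k) (allowed (D-condition t) (suc k)) h
  ≗ ⟦ Aₒ (suc k) ⊙ multiplesOf t (λ j → Eₒ (j * 2)) (suc k) ⟧ h
D-factor t k h =
  factor-A⊙when k (divᵇ t (suc k)) (allowed (D-condition t) (suc k)) h refl refl (λ _ → refl)

D≡common : ∀ t n → D (suc t * 2) n ≡ ⟦ common (suc t * 2) n ⟧ δ n
D≡common t n = begin
  D s n
    ≡⟨ cong (λ u → countPartitions (satisfies (D-condition u)) n) (m*n/n≡m t+1 2) ⟩
  countPartitions (satisfies (D-condition t+1)) n
    ≡⟨ countPartitions≡genFun (D-condition t+1) n ⟩
  genFun (D-condition t+1) n n
    ≡⟨ genFun≗prod _ F (D-factor t+1) n n ⟩
  ⟦ prod F n ⟧ δ n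
    ≡⟨ prod-⊙ Aₒ (multiplesOf t+1 G) n δ n ⟩
  ⟦ prod Aₒ n ⟧ Y n
    ≡⟨ ⟦⟧-≈ (prod Aₒ n) n Y≈ n ≤-refl ⟩
  ⟦ prod Aₒ n ⊙ prod (λ j → G (j * t+1)) n ⟧ δ n
    ≡⟨ ⟦⟧-cong (prod Aₒ n) (prod-cong _ _ n assoc δ) n ⟩
  ⟦ common s n ⟧ δ n
    ∎
  where
  open ≡-Reasoning
  s = suc t * 2
  t+1 = suc t
  G = λ j → Eₒ (j * 2)
  F = λ k → Aₒ k ⊙ multiplesOf t+1 G k
  Y = ⟦ prod (multiplesOf t+1 G) n ⟧ δ
  Y≈ : Y ≈[ n ] ⟦ prod (λ j → G (j * t+1)) n ⟧ δ
  Y≈ = prod-multiplesOf-≈ n t G (λ k n<k → E-IdUpTo n (k * 2) (m<n⇒m<n*o 2 n<k)) δ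
  assoc : ∀ i → i < n → G (suc i * t+1) ≈ₒ Eₒ (suc i * s)
  assoc i _ h n' = cong (λ j → E j h n') (*-assoc (suc i) t+1 2)

theorem5 : (s : ℕ) → 4 ≤ s → 2 ∣ s → (n : ℕ) →
    (M s n ≡ C s n) × (C s n ≡ D s n)
theorem5 _ () (divides zero refl) n
theorem5 _ _  (divides (suc t) refl) n =
  trans (M≡common (t * 2) n) (sym C≡) , trans C≡ (sym (D≡common t n))
  where
  C≡ = C≡common (suc (t * 2)) (divides (suc t) refl) n
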